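{- Let $n\ge1$, $k\ge1$ and $1\le r\le n$. Then $|\mathcal{P}_n^{(k)}(r)|=T(n,k,r)$. Moreover, for $k\ge2$, $|\mathcal{P}_n^{(k)}(1)|=\sum_{r=1}^{n}T(n,k-1,r)$.
   Context: A weighted partition of $[n]=\{1,\dots,n\}$ with $k$ layers consists of a set partition $\pi^{(1)}$ of $[n]$ (first layer) and, for $2\le l\le k$, a collection $\pi^{(l)}$ (the $l$-th layer, possibly empty) of pairwise disjoint subsets of $[n]$, each of size at least $2$, such that every set of the $l$-th layer is contained in a single set of the $(l-1)$-th layer. Equivalently, it is a $k$-tuple of set partitions of $[n]$, each refining the previous one. $\mathcal{P}_n^{(k)}(r)$ denotes the set of weighted partitions of $[n]$ with $k$ layers whose first layer has exactly $r$ blocks. With $S(a,b)$ the Stirling numbers of the second kind, $T(n,k,r)=\sum_{n\ge i_1\ge i_2\ge\dots\ge i_{k-1}\ge r}\prod_{j=1}^{k}S(i_{j-1},i_j)$ with $i_0=n$, $i_k=r$ (for $k=1$ this is $S(n,r)$). -}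

module Defs where

open import Data.Nat using (ℕ; zero; suc; _+_; _*_; _∸_; _<ᵇ_)
open import Data.Bool using (Bool; true; false; not; _∧_)
open import Data.Fin using (Fin; toℕ)
open import Data.Vec using (Vec; []; _∷_; lookup)
open import Data.List using (List; length; filterᵇ; allFin; map; upTo)
open import Data.Nat.ListAction using (sum)
open import Data.Bool.ListAction using (all)
open import Data.Unit using (⊤)
open import Data.Empty using (⊥)
open import Data.Product using (_×_)
open import Relation.Binary.PropositionalEquality using (_≡_)

-- Set partitions of [n] = Fin n, encoded (without function
-- extensionality issues) by their equivalence relation, stored as an
-- n × n Boolean matrix:  rel R i j = true  iff i and j lie in the same block.

BoolMatrix : ℕ → Set
BoolMatrix n = Vec (Vec Bool n) n

rel : ∀ {n} → BoolMatrix n → Fin n → Fin n → Bool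
rel R i j = lookup (lookup R i) j

IsSetPartition : ∀ {n} → BoolMatrix n → Set
IsSetPartition {n} R =
  (∀ (i : Fin n) → rel R i i ≡ true) ×
  (∀ (i j : Fin n) → rel R i j ≡ true → rel R j i ≡ true) ×
  (∀ (i j l : Fin n) → rel R i j ≡ true → rel R j l ≡ true → rel R i l ≡ true)

isLeastOfBlock : ∀ {n} → BoolMatrix n → Fin n → Bool
isLeastOfBlock {n} R i = all (λ j → not ((toℕ j <ᵇ toℕ i) ∧ rel R j i)) (allFin n)

numBlocks : ∀ {n} → BoolMatrix n → ℕ
numBlocks {n} R = length (filterᵇ (isLeastOfBlock R) (allFin n))

Refines : ∀ {n} → BoolMatrix n → BoolMatrix n → Set
Refines {n} S R = ∀ (i j : Fin n) → rel S i j ≡ true → rel R i j ≡ true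

AllPartitions : ∀ {n k} → Vec (BoolMatrix n) k → Set
AllPartitions [] = ⊤
AllPartitions (R ∷ Rs) = IsSetPartition R × AllPartitions Rs

RefiningChain : ∀ {n k} → Vec (BoolMatrix n) k → Set
RefiningChain [] = ⊤
RefiningChain (R ∷ []) = ⊤
RefiningChain (R ∷ S ∷ Rs) = Refines S R × RefiningChain (S ∷ Rs)

FirstLayerBlocks : ∀ {n k} → Vec (BoolMatrix n) k → ℕ → Set
FirstLayerBlocks [] r = ⊥
FirstLayerBlocks (R ∷ Rs) r = numBlocks R ≡ r

-- 𝒫ₙ^(k)(r): weighted partitions of [n] with k layers (as k-tuples of
-- successively refining set partitions) whose first layer has r blocks.
-- Proof fields are irrelevant, so an element is determined by its layers.
record WeightedPartition (n k r : ℕ) : Set where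
  constructor wp
  field
    layers : Vec (BoolMatrix n) k
    .isPartitions : AllPartitions layers
    .isChain : RefiningChain layers
    .firstBlocks : FirstLayerBlocks layers r

S : ℕ → ℕ → ℕ
S zero zero = 1
S zero (suc b) = 0
S (suc a) zero = 0
S (suc a) (suc b) = suc b * S a (suc b) + S a b

-- Σ_{i=a}^{b} f i  (empty if b < a)
sumRange : ℕ → ℕ → (ℕ → ℕ) → ℕ
sumRange a b f = sum (map (λ i → f (a + i)) (upTo (suc b ∸ a)))

-- T(n,k,r) = Σ_{n ≥ i₁ ≥ … ≥ i_{k-1} ≥ r} Π_{j=1}^{k} S(i_{j-1}, i_j),
-- i₀ = n, i_k = r, written as an iterated sum over i₁ (then i₂, …).
-- (k = 0 is not used; it is set to 0.)
T : ℕ → ℕ → ℕ → ℕ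
T n zero r = 0
T n (suc zero) r = S n r
T n (suc (suc k)) r = sumRange r n (λ i → S n i * T i (suc k) r)

{-# OPTIONS --safe #-}
-- Deleting the first layer of a weighted partition with k + 1 layers leaves one with k layers
-- whose first layer has some number j of blocks, and the deleted layer is a coarsening of
-- that layer, i.e. (after collapsing each of its j blocks to a point) a set partition of [j]
-- into r blocks.  Hence the count satisfies T(n, k+1, r) = Σ_j T(n, k, j) S(j, r): the
-- definition of T peels off the first Stirling factor, this identity the last one, and the
-- two agree by exchanging the order of summation.  For r = 1 the last factor S(j, 1) is 1.
-- Set partitions of [n] into b blocks are counted by S(n, b) through their inductive
-- description: the element 0 either opens a new block or joins one of the b blocks of a
-- partition of the remaining elements.
module Submission where

open import Defs
open import Data.Nat using (ℕ; zero; suc; _+_; _*_; _∸_; _≤_; _<_; z≤n; s≤s; _<ᵇ_)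
import Data.Nat.Properties as ℕ
open import Data.Nat.ListAction using (sum)
open import Data.Fin using (Fin; zero; suc; toℕ; fromℕ<)
import Data.Fin.Properties as Fin
open import Data.Bool using (Bool; true; false; not; _∧_)
import Data.Bool.Properties as Bool
open import Data.Bool.ListAction using (all)
open import Data.List using (filterᵇ; applyUpTo)
import Data.List as List
open import Data.Vec using (Vec; []; _∷_; lookup; tabulate)
import Data.Vec as Vec
import Data.Vec.Properties as Vec
open import Data.Product using (Σ; Σ-syntax; _×_; _,_; proj₁; proj₂)
open import Data.Sum using (_⊎_; inj₁; inj₂)
open import Data.Unit using (tt)
open import Function using (_∘_; id)
open import Function.Definitions using (Injective)
open import Function.Bundles using (_↔_; mk↔ₛ′; mk⇔)
open import Function.Construct.Symmetry using (↔-sym)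
open import Function.Construct.Identity using (↔-id)
open import Function.Construct.Composition using (_↔-∘_)
open import Function.Related.Propositional using (module EquationalReasoning; K-reflexive)
open import Data.Product.Function.NonDependent.Propositional using (_×-↔_)
open import Data.Product.Function.Dependent.Propositional using (congˡ)
open import Data.Sum.Function.Propositional using (_⊎-↔_)
open import Relation.Nullary using (Dec; yes; no; contradiction)
open import Relation.Nullary.Decidable using (recompute)
open import Relation.Binary.PropositionalEquality
open import Algebra.Properties.Semiring.Sum ℕ.+-*-semiring
  using (sum-syntax; sum-cong-≗; ∑-comm; *-distribˡ-sum; *-distribʳ-sum)
open import Algebra.Properties.CommutativeSemigroup ℕ.+-commutativeSemigroup using (x∙yz≈y∙xz)

private
  variable
    n m m′ b r : ℕ

infix 4 _≡ᵇ_

_≡ᵇ_ : Fin n → Fin n → Bool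
zero ≡ᵇ zero = true
zero ≡ᵇ suc _ = false
suc _ ≡ᵇ zero = false
suc a ≡ᵇ suc a′ = a ≡ᵇ a′

≡ᵇ-refl : (a : Fin n) → (a ≡ᵇ a) ≡ true
≡ᵇ-refl zero = refl
≡ᵇ-refl (suc a) = ≡ᵇ-refl a

≡ᵇ⇒≡ : (a a′ : Fin n) → (a ≡ᵇ a′) ≡ true → a ≡ a′
≡ᵇ⇒≡ zero zero _ = refl
≡ᵇ⇒≡ (suc a) (suc a′) e = cong suc (≡ᵇ⇒≡ a a′ e)

≡⇒≡ᵇ : {a a′ : Fin n} → a ≡ a′ → (a ≡ᵇ a′) ≡ true
≡⇒≡ᵇ {a = a} refl = ≡ᵇ-refl a

toℕᵇ : Bool → ℕ
toℕᵇ true = 1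
toℕᵇ false = 0

count : (Fin n → Bool) → ℕ
count {zero} p = 0
count {suc n} p = toℕᵇ (p zero) + count (p ∘ suc)

allᶠ : (Fin n → Bool) → Bool
allᶠ {zero} p = true
allᶠ {suc n} p = p zero ∧ allᶠ (p ∘ suc)

count-cong : {p q : Fin n → Bool} → (∀ i → p i ≡ q i) → count p ≡ count q
count-cong {zero} h = refl
count-cong {suc n} h = cong₂ _+_ (cong toℕᵇ (h zero)) (count-cong (h ∘ suc))

allᶠ-cong : {p q : Fin n → Bool} → (∀ i → p i ≡ q i) → allᶠ p ≡ allᶠ q
allᶠ-cong {zero} h = refl
allᶠ-cong {suc n} h = cong₂ _∧_ (h zero) (allᶠ-cong (h ∘ suc))

allᶠ-true : ∀ n → allᶠ {n} (λ _ → true) ≡ true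
allᶠ-true zero = refl
allᶠ-true (suc n) = allᶠ-true n

count-true : ∀ n → count {n} (λ _ → true) ≡ n
count-true zero = refl
count-true (suc n) = cong suc (count-true n)

length-filterᵇ-tabulate : {A : Set} (p : A → Bool) (f : Fin n → A) →
  List.length (filterᵇ p (List.tabulate f)) ≡ count (p ∘ f)
length-filterᵇ-tabulate {zero} p f = refl
length-filterᵇ-tabulate {suc n} p f with p (f zero)
... | true = cong suc (length-filterᵇ-tabulate p (f ∘ suc))
... | false = length-filterᵇ-tabulate p (f ∘ suc)

all-tabulate : {A : Set} (p : A → Bool) (f : Fin n → A) →
  all p (List.tabulate f) ≡ allᶠ (p ∘ f)
all-tabulate {zero} p f = refl
all-tabulate {suc n} p f = cong (p (f zero) ∧_) (all-tabulate p (f ∘ suc))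

count-split : (c : Fin b) (p : Fin b → Bool) →
  toℕᵇ (p c) + count (λ a → not (c ≡ᵇ a) ∧ p a) ≡ count p
count-split zero p = refl
count-split {suc b} (suc c) p = begin
  toℕᵇ (p (suc c)) + (toℕᵇ (p zero) + rest)   ≡⟨ x∙yz≈y∙xz (toℕᵇ (p (suc c))) (toℕᵇ (p zero)) rest ⟩
  toℕᵇ (p zero) + (toℕᵇ (p (suc c)) + rest)   ≡⟨ cong (toℕᵇ (p zero) +_) (count-split c (p ∘ suc)) ⟩
  count p                                     ∎
  where
  open ≡-Reasoning
  rest : ℕ
  rest = count (λ a → not (c ≡ᵇ a) ∧ p (suc a))

-- Set partitions of Fin n into b blocks, built by adding the element 0 in front

data Partition : ℕ → ℕ → Set where
  empty : Partition 0 0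
  new   : Partition n b → Partition (suc n) (suc b)
  join  : Fin b → Partition n b → Partition (suc n) b

block : Partition n b → Fin n → Fin b
block (new π) zero = zero
block (new π) (suc x) = suc (block π x)
block (join c π) zero = c
block (join c π) (suc x) = block π x

rep : Partition n b → Fin b → Fin n
rep (new π) zero = zero
rep (new π) (suc a) = suc (rep π a)
rep (join c π) a = suc (rep π a)

block-rep : (π : Partition n b) (a : Fin b) → block π (rep π a) ≡ a
block-rep (new π) zero = refl
block-rep (new π) (suc a) = cong suc (block-rep π a)
block-rep (join c π) a = block-rep π a

Partition-suc↔ : Partition (suc n) (suc b) ↔ ((Fin (suc b) × Partition n (suc b)) ⊎ Partition n b)
Partition-suc↔ {n} {b} = mk↔ₛ′ to from to∘from from∘to
  where
  to : Partition (suc n) (suc b) → (Fin (suc b) × Partition n (suc b)) ⊎ Partition n b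
  to (new π) = inj₂ π
  to (join c π) = inj₁ (c , π)
  from : (Fin (suc b) × Partition n (suc b)) ⊎ Partition n b → Partition (suc n) (suc b)
  from (inj₁ (c , π)) = join c π
  from (inj₂ π) = new π
  to∘from : ∀ y → to (from y) ≡ y
  to∘from (inj₁ _) = refl
  to∘from (inj₂ _) = refl
  from∘to : ∀ x → from (to x) ≡ x
  from∘to (new π) = refl
  from∘to (join c π) = refl

Partition↔S : ∀ n b → Partition n b ↔ Fin (S n b)
Partition↔S zero zero = mk↔ₛ′ (λ _ → zero) (λ _ → empty) (λ { zero → refl }) (λ { empty → refl })
Partition↔S zero (suc b) = mk↔ₛ′ (λ ()) (λ ()) (λ ()) (λ ())
Partition↔S (suc n) zero = mk↔ₛ′ (λ { (join () _) }) (λ ()) (λ ()) (λ { (join () _) })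
Partition↔S (suc n) (suc b) = begin
  Partition (suc n) (suc b)                              ↔⟨ Partition-suc↔ ⟩
  ((Fin (suc b) × Partition n (suc b)) ⊎ Partition n b)
    ↔⟨ (↔-id _ ×-↔ Partition↔S n (suc b)) ⊎-↔ Partition↔S n b ⟩
  ((Fin (suc b) × Fin (S n (suc b))) ⊎ Fin (S n b))      ↔⟨ ↔-sym Fin.*↔× ⊎-↔ ↔-id _ ⟩
  (Fin (suc b * S n (suc b)) ⊎ Fin (S n b))              ↔⟨ ↔-sym Fin.+↔⊎ ⟩
  Fin (S (suc n) (suc b))                                ∎
  where open EquationalReasoning

tabulateMatrix : (Fin n → Fin n → Bool) → BoolMatrix n
tabulateMatrix f = tabulate (λ i → tabulate (f i))

rel-tabulateMatrix : (f : Fin n → Fin n → Bool) (i j : Fin n) → rel (tabulateMatrix f) i j ≡ f i j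
rel-tabulateMatrix f i j rewrite Vec.lookup∘tabulate (λ i → tabulate (f i)) i = Vec.lookup∘tabulate (f i) j

vector-ext : {A : Set} {u v : Vec A n} → (∀ i → lookup u i ≡ lookup v i) → u ≡ v
vector-ext {u = u} {v} h =
  trans (sym (Vec.tabulate∘lookup u)) (trans (Vec.tabulate-cong h) (Vec.tabulate∘lookup v))

matrix-ext : {R R′ : BoolMatrix n} → (∀ i j → rel R i j ≡ rel R′ i j) → R ≡ R′
matrix-ext h = vector-ext (λ i → vector-ext (h i))

matrix-recompute : {R R′ : BoolMatrix n} → .(R ≡ R′) → R ≡ R′
matrix-recompute {R = R} {R′} = recompute (Vec.≡-dec (Vec.≡-dec Bool._≟_) R R′)

tailMatrix : BoolMatrix (suc n) → BoolMatrix n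
tailMatrix (_ ∷ rows) = Vec.map Vec.tail rows

lookup-tail : {A : Set} (v : Vec A (suc n)) (j : Fin n) → lookup (Vec.tail v) j ≡ lookup v (suc j)
lookup-tail (_ ∷ _) j = refl

rel-tailMatrix : (R : BoolMatrix (suc n)) (i j : Fin n) → rel (tailMatrix R) i j ≡ rel R (suc i) (suc j)
rel-tailMatrix (_ ∷ rows) i j rewrite Vec.lookup-map i Vec.tail rows = lookup-tail (lookup rows i) j

module SetPartitionRel {R : BoolMatrix n} (P : IsSetPartition R) where

  rel-refl : ∀ i → rel R i i ≡ true
  rel-refl = proj₁ P

  rel-sym : ∀ {i j} → rel R i j ≡ true → rel R j i ≡ true
  rel-sym = proj₁ (proj₂ P) _ _

  rel-trans : ∀ {i j l} → rel R i j ≡ true → rel R j l ≡ true → rel R i l ≡ true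
  rel-trans = proj₂ (proj₂ P) _ _ _

  rel-resp : ∀ {x x′ y y′} → rel R x x′ ≡ true → rel R y y′ ≡ true → rel R x y ≡ rel R x′ y′
  rel-resp x~x′ y~y′ = Bool.⇔→≡ {z = true} (mk⇔
    (λ x~y → rel-trans (rel-trans (rel-sym x~x′) x~y) y~y′)
    (λ x′~y′ → rel-trans (rel-trans x~x′ x′~y′) (rel-sym y~y′)))

  rel-false-sym : ∀ {x y} → rel R x y ≡ false → rel R y x ≡ false
  rel-false-sym x≁y = Bool.¬-not (λ y~x → Bool.not-¬ x≁y (rel-sym y~x))

tailMatrix-isSetPartition : {R : BoolMatrix (suc n)} → IsSetPartition R → IsSetPartition (tailMatrix R)
tailMatrix-isSetPartition {R = R} P =
  (λ i → trans (rel-tailMatrix R i i) (rel-refl (suc i))) ,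
  (λ i j h → trans (rel-tailMatrix R j i) (rel-sym (trans (sym (rel-tailMatrix R i j)) h))) ,
  (λ i j l h₁ h₂ → trans (rel-tailMatrix R i l)
     (rel-trans (trans (sym (rel-tailMatrix R i j)) h₁) (trans (sym (rel-tailMatrix R j l)) h₂)))
  where open SetPartitionRel {R = R} P

record Kernel (R : BoolMatrix n) (f : Fin n → Fin m) : Set where
  constructor kernel
  field
    rel≡ᵇ : ∀ x y → rel R x y ≡ (f x ≡ᵇ f y)
open Kernel

module _ {R : BoolMatrix n} {f : Fin n → Fin m} (K : Kernel R f) where

  kernel⇒≡ : ∀ {x y} → rel R x y ≡ true → f x ≡ f y
  kernel⇒≡ {x} {y} h = ≡ᵇ⇒≡ (f x) (f y) (trans (sym (rel≡ᵇ K x y)) h)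

  ≡⇒kernel : ∀ {x y} → f x ≡ f y → rel R x y ≡ true
  ≡⇒kernel {x} {y} e = trans (rel≡ᵇ K x y) (≡⇒≡ᵇ e)

  kernel-isSetPartition : IsSetPartition R
  kernel-isSetPartition =
    (λ i → ≡⇒kernel refl) ,
    (λ i j h → ≡⇒kernel (sym (kernel⇒≡ h))) ,
    (λ i j l h₁ h₂ → ≡⇒kernel (trans (kernel⇒≡ h₁) (kernel⇒≡ h₂)))

tailMatrix-kernel : {R : BoolMatrix (suc n)} {f : Fin (suc n) → Fin m} →
  Kernel R f → Kernel (tailMatrix R) (f ∘ suc)
tailMatrix-kernel {R = R} K = kernel (λ x y → trans (rel-tailMatrix R x y) (rel≡ᵇ K (suc x) (suc y)))

kernel-suc⁻¹ : {R : BoolMatrix n} {f : Fin n → Fin m} → Kernel R (λ x → Fin.suc (f x)) → Kernel R f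
kernel-suc⁻¹ K = kernel (rel≡ᵇ K)

kernel-unique : {R R′ : BoolMatrix n} {f : Fin n → Fin m} → Kernel R f → Kernel R′ f → R ≡ R′
kernel-unique K K′ = matrix-ext (λ i j → trans (rel≡ᵇ K i j) (sym (rel≡ᵇ K′ i j)))

encode : Partition n b → BoolMatrix n
encode π = tabulateMatrix (λ x y → block π x ≡ᵇ block π y)

encode-kernel : (π : Partition n b) → Kernel (encode π) (block π)
encode-kernel π = kernel (rel-tabulateMatrix (λ x y → block π x ≡ᵇ block π y))

tailMatrix-encode-new : (π : Partition n b) → tailMatrix (encode (new π)) ≡ encode π
tailMatrix-encode-new π =
  kernel-unique (kernel-suc⁻¹ {f = block π} (tailMatrix-kernel (encode-kernel (new π)))) (encode-kernel π)

tailMatrix-encode-join : (c : Fin b) (π : Partition n b) → tailMatrix (encode (join c π)) ≡ encode π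
tailMatrix-encode-join c π = kernel-unique (tailMatrix-kernel (encode-kernel (join c π))) (encode-kernel π)

relatedToZero? : (R : BoolMatrix (suc n)) → Dec (Σ[ y ∈ Fin n ] rel R zero (suc y) ≡ true)
relatedToZero? R = Fin.any? (λ y → rel R zero (suc y) Bool.≟ true)

insertZero : {P : Fin n → Set} → Σ ℕ (Partition n) → Dec (Σ (Fin n) P) → Σ ℕ (Partition (suc n))
insertZero (b , π) (yes (y , _)) = b , join (block π y) π
insertZero (b , π) (no _) = suc b , new π

decode : BoolMatrix n → Σ ℕ (Partition n)
decode {zero} R = 0 , empty
decode {suc n} R = insertZero (decode (tailMatrix R)) (relatedToZero? R)

blockCount : BoolMatrix n → ℕ
blockCount R = proj₁ (decode R)

decoded : (R : BoolMatrix n) → Partition n (blockCount R)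
decoded R = proj₂ (decode R)

module _ {R : BoolMatrix (suc n)} (P : IsSetPartition R) (π : Partition n b)
         (K : Kernel (tailMatrix R) (block π)) where
  open SetPartitionRel {R = R} P

  private
    rel-suc : ∀ x y → rel R (suc x) (suc y) ≡ (block π x ≡ᵇ block π y)
    rel-suc x y = trans (sym (rel-tailMatrix R x y)) (rel≡ᵇ K x y)

    rel-join : ∀ {y} → rel R zero (suc y) ≡ true →
      ∀ x x′ → rel R x x′ ≡ (block (join (block π y) π) x ≡ᵇ block (join (block π y) π) x′)
    rel-join {y} 0~y zero zero = trans (rel-refl zero) (sym (≡ᵇ-refl (block π y)))
    rel-join {y} 0~y zero (suc x) = trans (rel-resp 0~y (rel-refl (suc x))) (rel-suc y x)
    rel-join {y} 0~y (suc x) zero = trans (rel-resp (rel-refl (suc x)) 0~y) (rel-suc x y)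
    rel-join {y} 0~y (suc x) (suc x′) = rel-suc x x′

    rel-new : (∀ y → rel R zero (suc y) ≡ false) →
      ∀ x x′ → rel R x x′ ≡ (block (new π) x ≡ᵇ block (new π) x′)
    rel-new 0≁ zero zero = rel-refl zero
    rel-new 0≁ zero (suc y) = 0≁ y
    rel-new 0≁ (suc x) zero = rel-false-sym (0≁ x)
    rel-new 0≁ (suc x) (suc y) = rel-suc x y

  kernel-join : ∀ {y} → rel R zero (suc y) ≡ true → Kernel R (block (join (block π y) π))
  kernel-join 0~y = kernel (rel-join 0~y)

  kernel-new : (∀ y → rel R zero (suc y) ≡ false) → Kernel R (block (new π))
  kernel-new 0≁ = kernel (rel-new 0≁)

decode-kernel : {R : BoolMatrix n} → IsSetPartition R → Kernel R (block (decoded R))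
decode-kernel {zero} P = kernel (λ ())
decode-kernel {suc n} {R} P
  with decode (tailMatrix R)
     | decode-kernel {R = tailMatrix R} (tailMatrix-isSetPartition {R = R} P)
     | relatedToZero? R
... | _ , π | K | yes (_ , 0~y) = kernel-join {R = R} P π K 0~y
... | _ , π | K | no ∄ = kernel-new {R = R} P π K (λ y → Bool.¬-not (λ 0~y → ∄ (y , 0~y)))

encode-decode : {R : BoolMatrix n} → IsSetPartition R → encode (decoded R) ≡ R
encode-decode {R = R} P = kernel-unique (encode-kernel (decoded R)) (decode-kernel P)

decode-encode : (π : Partition n b) → decode (encode π) ≡ (b , π)
decode-encode empty = refl
decode-encode (new π) rewrite tailMatrix-encode-new π | decode-encode π
  with relatedToZero? (encode (new π))
... | yes (y , 0~y) with () ← trans (sym (rel≡ᵇ (encode-kernel (new π)) zero (suc y))) 0~y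
... | no _ = refl
decode-encode (join c π) rewrite tailMatrix-encode-join c π | decode-encode π
  with relatedToZero? (encode (join c π))
... | yes (y , 0~y) = cong (λ a → _ , join a π) (sym (kernel⇒≡ (encode-kernel (join c π)) {zero} {suc y} 0~y))
... | no ∄ =
  contradiction (rep π c , ≡⇒kernel (encode-kernel (join c π)) {zero} {suc (rep π c)} (sym (block-rep π c))) ∄

numBlocks≡count : (R : BoolMatrix n) → numBlocks R ≡ count (isLeastOfBlock R)
numBlocks≡count R = length-filterᵇ-tabulate (isLeastOfBlock R) id

isLeastOfBlock≡allᶠ : (R : BoolMatrix n) (i : Fin n) →
  isLeastOfBlock R i ≡ allᶠ (λ j → not ((toℕ j <ᵇ toℕ i) ∧ rel R j i))
isLeastOfBlock≡allᶠ R i = all-tabulate (λ j → not ((toℕ j <ᵇ toℕ i) ∧ rel R j i)) id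

isLeastOfBlock-zero : (R : BoolMatrix (suc n)) → isLeastOfBlock R zero ≡ true
isLeastOfBlock-zero {n} R = trans (isLeastOfBlock≡allᶠ R zero) (allᶠ-true (suc n))

isLeastOfBlock-suc : (R : BoolMatrix (suc n)) (i : Fin n) →
  isLeastOfBlock R (suc i) ≡ not (rel R zero (suc i)) ∧ isLeastOfBlock (tailMatrix R) i
isLeastOfBlock-suc R i = begin
  isLeastOfBlock R (suc i)
    ≡⟨ isLeastOfBlock≡allᶠ R (suc i) ⟩
  not (rel R zero (suc i)) ∧ allᶠ (λ j → not ((toℕ j <ᵇ toℕ i) ∧ rel R (suc j) (suc i)))
    ≡⟨ cong (not (rel R zero (suc i)) ∧_) (allᶠ-cong (λ j →
         cong (λ z → not ((toℕ j <ᵇ toℕ i) ∧ z)) (sym (rel-tailMatrix R j i)))) ⟩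
  not (rel R zero (suc i)) ∧ allᶠ (λ j → not ((toℕ j <ᵇ toℕ i) ∧ rel (tailMatrix R) j i))
    ≡⟨ cong (not (rel R zero (suc i)) ∧_) (sym (isLeastOfBlock≡allᶠ (tailMatrix R) i)) ⟩
  not (rel R zero (suc i)) ∧ isLeastOfBlock (tailMatrix R) i
    ∎
  where open ≡-Reasoning

-- Each block of encode π has exactly one least element.
count-leastOfBlock : (π : Partition n b) (p : Fin b → Bool) →
  count (λ x → isLeastOfBlock (encode π) x ∧ p (block π x)) ≡ count p
count-leastOfBlock empty p = refl
count-leastOfBlock (new π) p = cong₂ _+_
  (cong (λ z → toℕᵇ (z ∧ p zero)) (isLeastOfBlock-zero (encode (new π))))
  (trans (count-cong (λ x → cong (_∧ p (suc (block π x))) (isLeastOfBlock-encode-new x)))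
         (count-leastOfBlock π (p ∘ suc)))
  where
  isLeastOfBlock-encode-new : ∀ x → isLeastOfBlock (encode (new π)) (suc x) ≡ isLeastOfBlock (encode π) x
  isLeastOfBlock-encode-new x = trans (isLeastOfBlock-suc (encode (new π)) x)
    (cong₂ (λ u R → not u ∧ isLeastOfBlock R x)
      (rel≡ᵇ (encode-kernel (new π)) zero (suc x)) (tailMatrix-encode-new π))
count-leastOfBlock (join c π) p = begin
  toℕᵇ (isLeastOfBlock (encode (join c π)) zero ∧ p c) + count (λ x → L′ x ∧ p (block π x))
    ≡⟨ cong₂ _+_ (cong (λ z → toℕᵇ (z ∧ p c)) (isLeastOfBlock-zero (encode (join c π))))
                 (count-cong reassociate) ⟩
  toℕᵇ (p c) + count (λ x → isLeastOfBlock (encode π) x ∧ p′ (block π x))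
    ≡⟨ cong (toℕᵇ (p c) +_) (count-leastOfBlock π p′) ⟩
  toℕᵇ (p c) + count p′
    ≡⟨ count-split c p ⟩
  count p
    ∎
  where
  open ≡-Reasoning
  L′ : Fin _ → Bool
  L′ x = isLeastOfBlock (encode (join c π)) (suc x)
  p′ : Fin _ → Bool
  p′ a = not (c ≡ᵇ a) ∧ p a
  reassociate : ∀ x → L′ x ∧ p (block π x) ≡ isLeastOfBlock (encode π) x ∧ p′ (block π x)
  reassociate x = begin
    L′ x ∧ p (block π x)
      ≡⟨ cong (_∧ p (block π x)) (isLeastOfBlock-suc (encode (join c π)) x) ⟩
    (not (rel (encode (join c π)) zero (suc x)) ∧ isLeastOfBlock (tailMatrix (encode (join c π))) x)
      ∧ p (block π x)
      ≡⟨ cong₂ (λ u R → (not u ∧ isLeastOfBlock R x) ∧ p (block π x))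
           (rel≡ᵇ (encode-kernel (join c π)) zero (suc x)) (tailMatrix-encode-join c π) ⟩
    (not (c ≡ᵇ block π x) ∧ isLeastOfBlock (encode π) x) ∧ p (block π x)
      ≡⟨ cong (_∧ p (block π x)) (Bool.∧-comm (not (c ≡ᵇ block π x)) _) ⟩
    (isLeastOfBlock (encode π) x ∧ not (c ≡ᵇ block π x)) ∧ p (block π x)
      ≡⟨ Bool.∧-assoc (isLeastOfBlock (encode π) x) _ _ ⟩
    isLeastOfBlock (encode π) x ∧ p′ (block π x)
      ∎

numBlocks-encode : (π : Partition n b) → numBlocks (encode π) ≡ b
numBlocks-encode {b = b} π = begin
  numBlocks (encode π)
    ≡⟨ numBlocks≡count (encode π) ⟩
  count (isLeastOfBlock (encode π))
    ≡⟨ count-cong (λ x → sym (Bool.∧-identityʳ (isLeastOfBlock (encode π) x))) ⟩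
  count (λ x → isLeastOfBlock (encode π) x ∧ true)
    ≡⟨ count-leastOfBlock π (λ _ → true) ⟩
  count {b} (λ _ → true)
    ≡⟨ count-true b ⟩
  b
    ∎
  where open ≡-Reasoning

-- The kernel proof is irrelevant so that labellings can be built from the irrelevant
-- proofs stored in a WeightedPartition; being a Boolean equation it is recomputable.
record Labelling (R : BoolMatrix n) (m : ℕ) : Set where
  constructor labelling
  field
    label      : Fin n → Fin m
    pick       : Fin m → Fin n
    label-pick : ∀ a → label (pick a) ≡ a
    .isKernel  : Kernel R label

open Labelling

labelKernel : {R : BoolMatrix n} (ℓ : Labelling R m) → Kernel R (label ℓ)
labelKernel {R = R} (labelling f _ _ K) =
  kernel (λ x y → recompute (rel R x y Bool.≟ (f x ≡ᵇ f y)) (rel≡ᵇ K x y))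

module _ {R : BoolMatrix n} (ℓ : Labelling R m) where

  sameBlock⇒sameLabel : ∀ {x y} → rel R x y ≡ true → label ℓ x ≡ label ℓ y
  sameBlock⇒sameLabel = kernel⇒≡ (labelKernel ℓ)

  sameLabel⇒sameBlock : ∀ {x y} → label ℓ x ≡ label ℓ y → rel R x y ≡ true
  sameLabel⇒sameBlock = ≡⇒kernel (labelKernel ℓ)

  pick-label : ∀ x → rel R x (pick ℓ (label ℓ x)) ≡ true
  pick-label x = sameLabel⇒sameBlock (sym (label-pick ℓ (label ℓ x)))

  isSetPartition : IsSetPartition R
  isSetPartition = kernel-isSetPartition (labelKernel ℓ)

  pick-injective : Injective _≡_ _≡_ (pick ℓ)
  pick-injective {a} {a′} e = trans (sym (label-pick ℓ a)) (trans (cong (label ℓ) e) (label-pick ℓ a′))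

  size≤ : m ≤ n
  size≤ = Fin.injective⇒≤ pick-injective

decodeLabelling : {R : BoolMatrix n} → .(IsSetPartition R) → Labelling R (blockCount R)
decodeLabelling {R = R} P = record
  { label = block (decoded R) ; pick = rep (decoded R) ; label-pick = block-rep (decoded R)
  ; isKernel = decode-kernel P }

labelling-size-unique : {R : BoolMatrix n} → Labelling R m → Labelling R m′ → m ≡ m′
labelling-size-unique ℓ ℓ′ = Fin.cantor-schröder-bernstein (relabel-injective ℓ ℓ′) (relabel-injective ℓ′ ℓ)
  where
  relabel-injective : ∀ {m m′} (ℓ : Labelling _ m) (ℓ′ : Labelling _ m′) →
    Injective _≡_ _≡_ (label ℓ′ ∘ pick ℓ)
  relabel-injective ℓ ℓ′ {a} {a′} e = begin
    a                      ≡⟨ label-pick ℓ a ⟨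
    label ℓ (pick ℓ a)     ≡⟨ sameBlock⇒sameLabel ℓ (sameLabel⇒sameBlock ℓ′ e) ⟩
    label ℓ (pick ℓ a′)    ≡⟨ label-pick ℓ a′ ⟩
    a′                     ∎
    where open ≡-Reasoning

numBlocks-labelling : {R : BoolMatrix n} → Labelling R m → numBlocks R ≡ m
numBlocks-labelling {m = m} {R = R} ℓ = begin
  numBlocks R                     ≡⟨ cong numBlocks (encode-decode (isSetPartition ℓ)) ⟨
  numBlocks (encode (decoded R))  ≡⟨ numBlocks-encode (decoded R) ⟩
  blockCount R                    ≡⟨ labelling-size-unique (decodeLabelling (isSetPartition ℓ)) ℓ ⟩
  m                               ∎
  where open ≡-Reasoning

blockCount≡ : {R : BoolMatrix n} → .(IsSetPartition R) → .(numBlocks R ≡ m) → blockCount R ≡ m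
blockCount≡ {m = m} {R = R} P e =
  recompute (blockCount R ℕ.≟ m) (trans (sym (numBlocks-labelling (decodeLabelling P))) e)

labellingOf : {R : BoolMatrix n} → .(IsSetPartition R) → .(numBlocks R ≡ m) → Labelling R m
labellingOf {R = R} P e = subst (Labelling R) (blockCount≡ P e) (decodeLabelling P)

record PartitionMatrix (n r : ℕ) : Set where
  constructor partitionMatrix
  field
    matrix       : BoolMatrix n
    .isPartition : IsSetPartition matrix
    .blocks      : numBlocks matrix ≡ r

partitionMatrix-≡ : {M M′ : PartitionMatrix n r} →
  PartitionMatrix.matrix M ≡ PartitionMatrix.matrix M′ → M ≡ M′
partitionMatrix-≡ {M = partitionMatrix _ _ _} {partitionMatrix _ _ _} refl = refl

subst-decoded : {d : Σ ℕ (Partition n)} {π : Partition n b} → d ≡ (b , π) → (E : proj₁ d ≡ b) →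
  subst (Partition n) E (proj₂ d) ≡ π
subst-decoded refl refl = refl

encode-subst : (E : b ≡ m) (π : Partition n b) → encode (subst (Partition n) E π) ≡ encode π
encode-subst refl π = refl

PartitionMatrix↔Partition : PartitionMatrix n r ↔ Partition n r
PartitionMatrix↔Partition {n} {r} = mk↔ₛ′ to from to∘from from∘to
  where
  to : PartitionMatrix n r → Partition n r
  to (partitionMatrix R P e) = subst (Partition n) (blockCount≡ P e) (decoded R)
  from : Partition n r → PartitionMatrix n r
  from π = partitionMatrix (encode π) (kernel-isSetPartition (encode-kernel π)) (numBlocks-encode π)
  to∘from : ∀ π → to (from π) ≡ π
  to∘from π = subst-decoded (decode-encode π) _
  from∘to : ∀ M → from (to M) ≡ M
  from∘to (partitionMatrix R P e) = partitionMatrix-≡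
    (trans (encode-subst (blockCount≡ P e) (decoded R)) (matrix-recompute (encode-decode P)))

PartitionMatrix↔S : PartitionMatrix n r ↔ Fin (S n r)
PartitionMatrix↔S {n} {r} = Partition↔S n r ↔-∘ PartitionMatrix↔Partition

-- Coarsenings of a set partition are the set partitions of its blocks

record Coarsening (R : BoolMatrix n) (r : ℕ) : Set where
  constructor coarsening
  field
    coarser      : BoolMatrix n
    .isPartition : IsSetPartition coarser
    .refines     : Refines R coarser
    .blocks      : numBlocks coarser ≡ r

coarsening-≡ : {R : BoolMatrix n} {C C′ : Coarsening R r} →
  Coarsening.coarser C ≡ Coarsening.coarser C′ → C ≡ C′
coarsening-≡ {C = coarsening _ _ _ _} {coarsening _ _ _ _} refl = refl

module Quotient {R : BoolMatrix n} (ℓ : Labelling R m) where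

  quotient : BoolMatrix n → BoolMatrix m
  quotient R₁ = tabulateMatrix (λ a a′ → rel R₁ (pick ℓ a) (pick ℓ a′))

  lift : BoolMatrix m → BoolMatrix n
  lift R′ = tabulateMatrix (λ x y → rel R′ (label ℓ x) (label ℓ y))

  quotientLabelling : {R₁ : BoolMatrix n} → Refines R R₁ → Labelling R₁ r → Labelling (quotient R₁) r
  quotientLabelling {R₁ = R₁} R⊆R₁ ℓ₁ = labelling (label ℓ₁ ∘ pick ℓ) (label ℓ ∘ pick ℓ₁) label-pick′
    (kernel (λ a a′ → trans (rel-tabulateMatrix _ a a′) (rel≡ᵇ (labelKernel ℓ₁) (pick ℓ a) (pick ℓ a′))))
    where
    label-pick′ : ∀ c → label ℓ₁ (pick ℓ (label ℓ (pick ℓ₁ c))) ≡ c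
    label-pick′ c =
      trans (sym (sameBlock⇒sameLabel ℓ₁ (R⊆R₁ _ _ (pick-label ℓ (pick ℓ₁ c))))) (label-pick ℓ₁ c)

  liftLabelling : {R′ : BoolMatrix m} → Labelling R′ r → Labelling (lift R′) r
  liftLabelling ℓ′ = labelling (label ℓ′ ∘ label ℓ) (pick ℓ ∘ pick ℓ′)
    (λ c → trans (cong (label ℓ′) (label-pick ℓ (pick ℓ′ c))) (label-pick ℓ′ c))
    (kernel (λ x y → trans (rel-tabulateMatrix _ x y) (rel≡ᵇ (labelKernel ℓ′) (label ℓ x) (label ℓ y))))

  lift-refines : {R′ : BoolMatrix m} → IsSetPartition R′ → Refines R (lift R′)
  lift-refines {R′} P′ x y x~y = trans (rel-tabulateMatrix _ x y)
    (trans (cong (rel R′ (label ℓ x)) (sym (sameBlock⇒sameLabel ℓ x~y))) (proj₁ P′ (label ℓ x)))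

  quotient-lift : (R′ : BoolMatrix m) → quotient (lift R′) ≡ R′
  quotient-lift R′ = matrix-ext λ a a′ → trans (rel-tabulateMatrix _ a a′)
    (trans (rel-tabulateMatrix _ (pick ℓ a) (pick ℓ a′)) (cong₂ (rel R′) (label-pick ℓ a) (label-pick ℓ a′)))

  -- R₁ is constant on the blocks of R, so it is determined by its values on their picks.
  lift-quotient : {R₁ : BoolMatrix n} → IsSetPartition R₁ → Refines R R₁ → lift (quotient R₁) ≡ R₁
  lift-quotient {R₁} P₁ R⊆R₁ = matrix-ext λ x y → trans (rel-tabulateMatrix _ x y)
    (trans (rel-tabulateMatrix _ (label ℓ x) (label ℓ y))
      (sym (rel-resp (R⊆R₁ _ _ (pick-label ℓ x)) (R⊆R₁ _ _ (pick-label ℓ y)))))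
    where open SetPartitionRel {R = R₁} P₁

  Coarsening↔PartitionMatrix : Coarsening R r ↔ PartitionMatrix m r
  Coarsening↔PartitionMatrix {r} = mk↔ₛ′ to from to∘from from∘to
    where
    to : Coarsening R r → PartitionMatrix m r
    to (coarsening R₁ P₁ R⊆R₁ e) = partitionMatrix (quotient R₁)
      (isSetPartition (quotientLabelling R⊆R₁ (labellingOf {R = R₁} P₁ e)))
      (numBlocks-labelling (quotientLabelling R⊆R₁ (labellingOf {R = R₁} P₁ e)))
    from : PartitionMatrix m r → Coarsening R r
    from (partitionMatrix R′ P′ e) = coarsening (lift R′)
      (isSetPartition (liftLabelling (labellingOf {R = R′} P′ e))) (lift-refines {R′} P′)
      (numBlocks-labelling (liftLabelling (labellingOf {R = R′} P′ e)))
    to∘from : ∀ M → to (from M) ≡ M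
    to∘from (partitionMatrix R′ _ _) = partitionMatrix-≡ (quotient-lift R′)
    from∘to : ∀ C → from (to C) ≡ C
    from∘to (coarsening R₁ P₁ R⊆R₁ _) = coarsening-≡ (matrix-recompute (lift-quotient P₁ R⊆R₁))

-- Removing the first layer

open WeightedPartition

headLayer : {k : ℕ} → WeightedPartition n (suc k) m → BoolMatrix n
headLayer w = Vec.head (layers w)

firstLayer↔ : {k : ℕ} → WeightedPartition n (suc (suc k)) r ↔
  (Σ[ j ∈ Fin (suc n) ] Σ[ w ∈ WeightedPartition n (suc k) (toℕ j) ] Coarsening (headLayer w) r)
firstLayer↔ {n} {r} {k} = mk↔ₛ′ to from to∘from from∘to
  where
  Removed : Set
  Removed = Σ[ j ∈ Fin (suc n) ] Σ[ w ∈ WeightedPartition n (suc k) (toℕ j) ] Coarsening (headLayer w) r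
  numBlocks< : (R : BoolMatrix n) → .(IsSetPartition R) → numBlocks R < suc n
  numBlocks< R P = s≤s (size≤ (labellingOf {R = R} P refl))
  to : WeightedPartition n (suc (suc k)) r → Removed
  to (wp (R₁ ∷ R ∷ Rs) P chain e) =
    fromℕ< (numBlocks< R (proj₁ (proj₂ P))) ,
    wp (R ∷ Rs) (proj₂ P) (proj₂ chain) (sym (Fin.toℕ-fromℕ< (numBlocks< R (proj₁ (proj₂ P))))) ,
    coarsening R₁ (proj₁ P) (proj₁ chain) e
  from : Removed → WeightedPartition n (suc (suc k)) r
  from (_ , wp (R ∷ Rs) P chain _ , coarsening R₁ P₁ R⊆R₁ e) = wp (R₁ ∷ R ∷ Rs) (P₁ , P) (R⊆R₁ , chain) e
  reindex : ∀ {j j′} → j ≡ j′ → (Rs : Vec (BoolMatrix n) (suc k)) →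
    ∀ .{P chain} .{e : FirstLayerBlocks Rs (toℕ j)} .{e′ : FirstLayerBlocks Rs (toℕ j′)}
    (C : Coarsening (Vec.head Rs) r) →
    _≡_ {A = Removed} (j , wp Rs P chain e , C) (j′ , wp Rs P chain e′ , C)
  reindex refl Rs C = refl
  to∘from : ∀ x → to (from x) ≡ x
  to∘from (j , wp (R ∷ Rs) P chain e , coarsening R₁ P₁ R⊆R₁ e₁) = reindex
    (Fin.toℕ-injective (trans (Fin.toℕ-fromℕ< (numBlocks< R (proj₁ P))) (recompute (_ ℕ.≟ toℕ j) e)))
    (R ∷ Rs) (coarsening R₁ P₁ R⊆R₁ e₁)
  from∘to : ∀ w → from (to w) ≡ w
  from∘to (wp (R₁ ∷ R ∷ Rs) _ _ _) = refl

Coarsening↔S : {k : ℕ} (w : WeightedPartition n (suc k) m) → Coarsening (headLayer w) r ↔ Fin (S m r)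
Coarsening↔S (wp (R ∷ _) P _ e) =
  PartitionMatrix↔S ↔-∘ Quotient.Coarsening↔PartitionMatrix (labellingOf {R = R} (proj₁ P) e)

Σ-Fin-suc↔ : {A : Fin (suc n) → Set} → Σ (Fin (suc n)) A ↔ (A zero ⊎ Σ (Fin n) (A ∘ suc))
Σ-Fin-suc↔ {n} {A} = mk↔ₛ′ to from to∘from from∘to
  where
  to : Σ (Fin (suc n)) A → A zero ⊎ Σ (Fin n) (A ∘ suc)
  to (zero , x) = inj₁ x
  to (suc j , x) = inj₂ (j , x)
  from : A zero ⊎ Σ (Fin n) (A ∘ suc) → Σ (Fin (suc n)) A
  from (inj₁ x) = zero , x
  from (inj₂ (j , x)) = suc j , x
  to∘from : ∀ y → to (from y) ≡ y
  to∘from (inj₁ _) = refl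
  to∘from (inj₂ _) = refl
  from∘to : ∀ x → from (to x) ≡ x
  from∘to (zero , _) = refl
  from∘to (suc _ , _) = refl

Σ-Fin↔∑ : {A : Fin n → Set} (f : Fin n → ℕ) → (∀ j → A j ↔ Fin (f j)) →
  Σ (Fin n) A ↔ Fin (∑[ j < n ] f j)
Σ-Fin↔∑ {zero} f A↔ = mk↔ₛ′ (λ { (() , _) }) (λ ()) (λ ()) (λ { (() , _) })
Σ-Fin↔∑ {suc n} {A} f A↔ = begin
  Σ (Fin (suc n)) A                          ↔⟨ Σ-Fin-suc↔ ⟩
  (A zero ⊎ Σ (Fin n) (A ∘ suc))             ↔⟨ A↔ zero ⊎-↔ Σ-Fin↔∑ (f ∘ suc) (A↔ ∘ suc) ⟩
  (Fin (f zero) ⊎ Fin (∑[ j < n ] f (suc j))) ↔⟨ ↔-sym Fin.+↔⊎ ⟩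
  Fin (∑[ j < suc n ] f j)                   ∎
  where open EquationalReasoning

sum-applyUpTo : ∀ m (h u : ℕ → ℕ) → sum (List.map h (applyUpTo u m)) ≡ ∑[ i < m ] h (u (toℕ i))
sum-applyUpTo zero h u = refl
sum-applyUpTo (suc m) h u = cong (h (u 0) +_) (sum-applyUpTo m h (u ∘ suc))

sumRange≡∑ : ∀ a b (g : ℕ → ℕ) → sumRange a b g ≡ ∑[ i < suc b ∸ a ] g (a + toℕ i)
sumRange≡∑ a b g = sum-applyUpTo (suc b ∸ a) (λ i → g (a + i)) id

∑-dropInitialZeros : ∀ a m (g : ℕ → ℕ) → (∀ i → i < a → g i ≡ 0) →
  ∑[ i < m ∸ a ] g (a + toℕ i) ≡ ∑[ i < m ] g (toℕ i)
∑-dropInitialZeros zero m g _ = refl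
∑-dropInitialZeros (suc a) zero g _ = refl
∑-dropInitialZeros (suc a) (suc m) g g<a≡0 =
  trans (∑-dropInitialZeros a m (g ∘ suc) (λ i i<a → g<a≡0 (suc i) (s≤s i<a)))
        (cong (_+ ∑[ i < m ] g (suc (toℕ i))) (sym (g<a≡0 0 (s≤s z≤n))))

∑-dropFinalZeros : ∀ m d (g : ℕ → ℕ) → (∀ i → m ≤ i → g i ≡ 0) →
  ∑[ i < m + d ] g (toℕ i) ≡ ∑[ i < m ] g (toℕ i)
∑-dropFinalZeros zero zero g _ = refl
∑-dropFinalZeros zero (suc d) g g≥0≡0 =
  trans (cong (_+ ∑[ i < d ] g (suc (toℕ i))) (g≥0≡0 0 z≤n))
        (∑-dropFinalZeros zero d (g ∘ suc) (λ i _ → g≥0≡0 (suc i) z≤n))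
∑-dropFinalZeros (suc m) d g g≥m≡0 =
  cong (g 0 +_) (∑-dropFinalZeros m d (g ∘ suc) (λ i m≤i → g≥m≡0 (suc i) (s≤s m≤i)))

sumRange≡∑-initial : ∀ a b N (g : ℕ → ℕ) → b ≤ N →
  (∀ i → i < a → g i ≡ 0) → (∀ i → b < i → g i ≡ 0) → sumRange a b g ≡ ∑[ i < suc N ] g (toℕ i)
sumRange≡∑-initial a b N g b≤N g<a≡0 g>b≡0 = begin
  sumRange a b g                           ≡⟨ sumRange≡∑ a b g ⟩
  ∑[ i < suc b ∸ a ] g (a + toℕ i)         ≡⟨ ∑-dropInitialZeros a (suc b) g g<a≡0 ⟩
  ∑[ i < suc b ] g (toℕ i)                 ≡⟨ ∑-dropFinalZeros (suc b) (N ∸ b) g g>b≡0 ⟨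
  ∑[ i < suc b + (N ∸ b) ] g (toℕ i)       ≡⟨ cong (λ m → ∑[ i < suc m ] g (toℕ i)) (ℕ.m+[n∸m]≡n b≤N) ⟩
  ∑[ i < suc N ] g (toℕ i)                 ∎
  where open ≡-Reasoning

-- The recursion of T through its last factor

S-vanishes : ∀ {a b} → a < b → S a b ≡ 0
S-vanishes {zero} {suc b} _ = refl
S-vanishes {suc a} {suc b} (s≤s a<b) = begin
  suc b * S a (suc b) + S a b
    ≡⟨ cong₂ (λ x y → suc b * x + y) (S-vanishes (ℕ.m<n⇒m<1+n a<b)) (S-vanishes a<b) ⟩
  suc b * 0 + 0
    ≡⟨ cong (_+ 0) (ℕ.*-zeroʳ (suc b)) ⟩
  0
    ∎
  where open ≡-Reasoning

T-vanishes : ∀ k {i r} → i < r → T i (suc k) r ≡ 0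
T-vanishes zero i<r = S-vanishes i<r
T-vanishes (suc k) {i} {r} i<r = begin
  sumRange r i g                   ≡⟨ sumRange≡∑ r i g ⟩
  ∑[ j < suc i ∸ r ] g (r + toℕ j) ≡⟨ cong (λ m → ∑[ j < m ] g (r + toℕ j)) (ℕ.m≤n⇒m∸n≡0 i<r) ⟩
  0                                ∎
  where
  open ≡-Reasoning
  g : ℕ → ℕ
  g j = S i j * T j (suc k) r

S-suc-1 : ∀ j → S (suc j) 1 ≡ 1
S-suc-1 zero = refl
S-suc-1 (suc j) = trans (ℕ.+-identityʳ _) (trans (ℕ.+-identityʳ _) (S-suc-1 j))

T-expand : ∀ k n r N → n ≤ N → T n (suc (suc k)) r ≡ ∑[ i < suc N ] (S n (toℕ i) * T (toℕ i) (suc k) r)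
T-expand k n r N n≤N = sumRange≡∑-initial r n N (λ i → S n i * T i (suc k) r) n≤N
  (λ i i<r → trans (cong (S n i *_) (T-vanishes k i<r)) (ℕ.*-zeroʳ (S n i)))
  (λ i n<i → cong (_* T i (suc k) r) (S-vanishes n<i))

T-lastLayer : ∀ k n r N → n ≤ N → T n (suc (suc k)) r ≡ ∑[ j < suc N ] (T n (suc k) (toℕ j) * S (toℕ j) r)
T-lastLayer zero n r N n≤N = T-expand zero n r N n≤N
T-lastLayer (suc k) n r N n≤N = begin
  T n (3 + k) r
    ≡⟨ T-expand (suc k) n r N n≤N ⟩
  ∑[ i < suc N ] (S n (toℕ i) * T (toℕ i) (2 + k) r)
    ≡⟨ sum-cong-≗ {suc N} (λ i → cong (S n (toℕ i) *_) (T-lastLayer k (toℕ i) r N (Fin.toℕ≤pred[n] i))) ⟩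
  ∑[ i < suc N ] (S n (toℕ i) * ∑[ j < suc N ] (T (toℕ i) (suc k) (toℕ j) * S (toℕ j) r))
    ≡⟨ sum-cong-≗ {suc N} (λ i →
         *-distribˡ-sum {suc N} (S n (toℕ i)) (λ j → T (toℕ i) (suc k) (toℕ j) * S (toℕ j) r)) ⟩
  ∑[ i < suc N ] ∑[ j < suc N ] (S n (toℕ i) * (T (toℕ i) (suc k) (toℕ j) * S (toℕ j) r))
    ≡⟨ ∑-comm {suc N} {suc N} (λ i j → S n (toℕ i) * (T (toℕ i) (suc k) (toℕ j) * S (toℕ j) r)) ⟩
  ∑[ j < suc N ] ∑[ i < suc N ] (S n (toℕ i) * (T (toℕ i) (suc k) (toℕ j) * S (toℕ j) r))
    ≡⟨ sum-cong-≗ {suc N} (λ j → trans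
         (sum-cong-≗ {suc N} (λ i → sym (ℕ.*-assoc (S n (toℕ i)) (T (toℕ i) (suc k) (toℕ j)) (S (toℕ j) r))))
         (sym (*-distribʳ-sum {suc N} (S (toℕ j) r) (λ i → S n (toℕ i) * T (toℕ i) (suc k) (toℕ j))))) ⟩
  ∑[ j < suc N ] ((∑[ i < suc N ] (S n (toℕ i) * T (toℕ i) (suc k) (toℕ j))) * S (toℕ j) r)
    ≡⟨ sum-cong-≗ {suc N} (λ j → cong (_* S (toℕ j) r) (T-expand k n (toℕ j) N n≤N)) ⟨
  ∑[ j < suc N ] (T n (2 + k) (toℕ j) * S (toℕ j) r)
    ∎
  where open ≡-Reasoning

T-singleBlock : ∀ k n → T n (suc (suc k)) 1 ≡ sumRange 1 n (λ r → T n (suc k) r)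
T-singleBlock k n = begin
  T n (2 + k) 1
    ≡⟨ T-lastLayer k n 1 n ℕ.≤-refl ⟩
  T n (suc k) 0 * 0 + ∑[ j < n ] (T n (suc k) (suc (toℕ j)) * S (suc (toℕ j)) 1)
    ≡⟨ cong (_+ ∑[ j < n ] (T n (suc k) (suc (toℕ j)) * S (suc (toℕ j)) 1)) (ℕ.*-zeroʳ (T n (suc k) 0)) ⟩
  ∑[ j < n ] (T n (suc k) (suc (toℕ j)) * S (suc (toℕ j)) 1)
    ≡⟨ sum-cong-≗ {n} (λ j →
         trans (cong (T n (suc k) (suc (toℕ j)) *_) (S-suc-1 (toℕ j))) (ℕ.*-identityʳ _)) ⟩
  ∑[ j < n ] T n (suc k) (suc (toℕ j))
    ≡⟨ sumRange≡∑ 1 n (T n (suc k)) ⟨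
  sumRange 1 n (λ r → T n (suc k) r)
    ∎
  where open ≡-Reasoning

WeightedPartition↔T : ∀ k n r → WeightedPartition n (suc k) r ↔ Fin (T n (suc k) r)
WeightedPartition↔T zero n r = PartitionMatrix↔S ↔-∘ oneLayer↔
  where
  oneLayer↔ : WeightedPartition n 1 r ↔ PartitionMatrix n r
  oneLayer↔ = mk↔ₛ′ (λ { (wp (R ∷ []) P _ e) → partitionMatrix R (proj₁ P) e })
    (λ { (partitionMatrix R P e) → wp (R ∷ []) (P , tt) tt e })
    (λ { (partitionMatrix _ _ _) → refl }) (λ { (wp (_ ∷ []) _ _ _) → refl })
WeightedPartition↔T (suc k) n r = begin
  WeightedPartition n (2 + k) r
    ↔⟨ firstLayer↔ ⟩
  (Σ[ j ∈ Fin (suc n) ] Σ[ w ∈ WeightedPartition n (suc k) (toℕ j) ] Coarsening (headLayer w) r)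
    ↔⟨ congˡ (congˡ (λ {w} → Coarsening↔S w)) ⟩
  (Σ[ j ∈ Fin (suc n) ] (WeightedPartition n (suc k) (toℕ j) × Fin (S (toℕ j) r)))
    ↔⟨ Σ-Fin↔∑ _ (λ j → ↔-sym Fin.*↔× ↔-∘ (WeightedPartition↔T k n (toℕ j) ×-↔ ↔-id _)) ⟩
  Fin (∑[ j < suc n ] (T n (suc k) (toℕ j) * S (toℕ j) r))
    ≡⟨ cong Fin (T-lastLayer k n r n ℕ.≤-refl) ⟨
  Fin (T n (2 + k) r)
    ∎
  where open EquationalReasoning

mainTheorem4 : ((n k r : ℕ) → 1 ≤ n → 1 ≤ k → 1 ≤ r → r ≤ n →
                   WeightedPartition n k r ↔ Fin (T n k r))
                 × ((n k : ℕ) → 1 ≤ n → 2 ≤ k →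
                   WeightedPartition n k 1 ↔ Fin (sumRange 1 n (λ r → T n (k ∸ 1) r)))
mainTheorem4 = counting , singleBlock
  where
  -- The bijections exist for all n and r; only the bound on k is needed.
  counting : (n k r : ℕ) → 1 ≤ n → 1 ≤ k → 1 ≤ r → r ≤ n → WeightedPartition n k r ↔ Fin (T n k r)
  counting n (suc k) r _ _ _ _ = WeightedPartition↔T k n r
  singleBlock : (n k : ℕ) → 1 ≤ n → 2 ≤ k →
    WeightedPartition n k 1 ↔ Fin (sumRange 1 n (λ r → T n (k ∸ 1) r))
  singleBlock n (suc zero) _ (s≤s ())
  singleBlock n (suc (suc k)) _ _ =
    K-reflexive (cong Fin (T-singleBlock k n)) ↔-∘ WeightedPartition↔T (suc k) n 1
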